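{- Let $D$ be a digraph and $s,t\in V(D)$ such that the minimum size $\ell$ of an $s$-$t$ separator satisfies $\ell>0$, and let $X_1,\dots,X_q$ be vertex sets with $\{s\}\subseteq X_i\subseteq V(D)\setminus(\{t\}\cup N^-(t))$ satisfying: $X_1\subset\cdots\subset X_q$; every vertex of $X_i$ is reachable from $s$ in $D[X_i]$ and every vertex of $N^+(X_i)$ can reach $t$ in $D-X_i$; $|N^+(X_i)|=\ell$ for all $i$; and every $s$-$t$ separator of size $\ell$ is contained in $\bigcup_{i=1}^qN^+(X_i)$. Define $X_0=\emptyset$, $X_{q+1}=V(D)$ and $Z_i=X_{i+1}\setminus N^+[X_i]$ for $0\le i\le q$. Then any minimal $s$-$t$ separator in $D$ that intersects $Z_i$ for some $0\le i\le q$ has size at least $\ell+1$.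
   Context: An $s$-$t$ separator is a set $S\subseteq V(D)\setminus\{s,t\}$ such that $D-S$ has no directed $s$-$t$ path; minimal means inclusion-minimal among such sets. $N^+(X)$ is the set of out-neighbours of $X$ outside $X$, $N^-(X)$ the in-neighbours outside $X$, and $N^+[X]=X\cup N^+(X)$. -}

module Defs where

open import Data.Nat using (ℕ; zero; suc; _<_; _≤_)
open import Data.Nat.Properties using (_<?_)
open import Data.Bool using (Bool; true; false; not; _∧_; _∨_)
open import Data.Fin using (Fin; fromℕ<)
open import Data.Fin.Subset using (Subset; _∈_; _∉_; _⊆_; _⊂_; ⊥; ⊤; _∪_; _─_; ∣_∣)
open import Data.Vec using (Vec; tabulate; lookup)
open import Data.Product using (Σ; _×_; ∃-syntax)
open import Relation.Nullary using (¬_; yes; no)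
open import Relation.Binary.PropositionalEquality using (_≡_)

Digraph : ℕ → Set
Digraph n = Fin n → Fin n → Bool

anyFin : ∀ {n} → (Fin n → Bool) → Bool
anyFin {zero}  f = false
anyFin {suc n} f = f Data.Fin.zero ∨ anyFin (λ i → f (Data.Fin.suc i))

Nout : ∀ {n} → Digraph n → Subset n → Subset n
Nout D X = tabulate λ v → not (lookup X v) ∧ anyFin (λ u → lookup X u ∧ D u v)

Nclosed : ∀ {n} → Digraph n → Subset n → Subset n
Nclosed D X = X ∪ Nout D X

data Reach {n} (D : Digraph n) (A : Subset n) : Fin n → Fin n → Set where
  here : ∀ {u} → u ∈ A → Reach D A u u
  step : ∀ {u w v} → u ∈ A → D u w ≡ true → Reach D A w v → Reach D A u v

IsSeparator : ∀ {n} → Digraph n → Fin n → Fin n → Subset n → Set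
IsSeparator D s t S = s ∉ S × t ∉ S × ¬ Reach D (Data.Fin.Subset.∁ S) s t

IsMinimalSeparator : ∀ {n} → Digraph n → Fin n → Fin n → Subset n → Set
IsMinimalSeparator D s t S =
  IsSeparator D s t S × (∀ S′ → S′ ⊆ S → IsSeparator D s t S′ → S ⊆ S′)

IsMinSepSize : ∀ {n} → Digraph n → Fin n → Fin n → ℕ → Set
IsMinSepSize D s t ℓ =
  (Σ (Subset _) λ S → IsSeparator D s t S × ∣ S ∣ ≡ ℓ)
  × (∀ S → IsSeparator D s t S → ℓ ≤ ∣ S ∣)

-- Extended sequence: X₀ = ∅, Xᵢ = X (i-1) for 1 ≤ i ≤ q, X_{q+1} = V(D).
-- (The given family X : Fin q → Subset n is 0-indexed: X k stands for X_{k+1}.)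
Xext : ∀ {n q} → (Fin q → Subset n) → ℕ → Subset n
Xext X zero = ⊥
Xext {q = q} X (suc i) with i <? q
... | yes p = X (fromℕ< p)
... | no _  = ⊤

Zset : ∀ {n q} → Digraph n → (Fin q → Subset n) → ℕ → Subset n
Zset D X i = Xext X (suc i) ─ Nclosed D (Xext X i)

-- A separator S of size at most ℓ is a minimum separator, so by hypothesis S ⊆ ⋃ₖ N⁺(Xₖ).
-- But the chain X₁ ⊂ ⋯ ⊂ X_q makes every N⁺(Xₖ) disjoint from every Zᵢ: if i ≤ k then
-- Zᵢ ⊆ X_{i+1} ⊆ Xₖ, which N⁺(Xₖ) avoids; if k < i then Xₖ ⊆ Xᵢ, so N⁺(Xₖ) ⊆ N⁺[Xᵢ],
-- which Zᵢ avoids. Hence a separator meeting some Zᵢ has more than ℓ vertices.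
module Submission where

open import Defs
open import Data.Nat using (ℕ; zero; suc; _<_; _≤_; z≤n)
open import Data.Nat.Properties using (_<?_; _≤?_; ≤-<-trans; ≤-antisym; ≮⇒≥; ≰⇒>)
open import Data.Bool using (Bool; true; false; not; _∧_)
open import Data.Fin using (Fin; zero; suc; toℕ; fromℕ<)
open import Data.Fin.Properties using (toℕ<n; toℕ-fromℕ<; toℕ-injective)
open import Data.Fin.Subset using (Subset; _∈_; _∉_; _⊆_; _⊂_; _─_; ∁; ∣_∣)
open import Data.Fin.Subset.Properties using (p⊆p∪q; q⊆p∪q; p─q⊆p; _∈?_; ∈⊤)
open import Data.Vec using (_∷_; there; lookup)
open import Data.Vec.Properties using (lookup∘tabulate; []=⇒lookup; lookup⇒[]=)
open import Data.Product using (_×_; _,_; proj₁; proj₂; ∃-syntax)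
open import Data.Empty using (⊥-elim)
open import Relation.Nullary using (yes; no; contradiction)
open import Relation.Binary.PropositionalEquality using (_≡_; refl; sym; trans; subst)

x∈p─q⇒x∉q : ∀ {n} (p q : Subset n) {x} → x ∈ p ─ q → x ∉ q
x∈p─q⇒x∉q (_ ∷ p) (true  ∷ q) (there x∈p─q) (there x∈q) = x∈p─q⇒x∉q p q x∈p─q x∈q
x∈p─q⇒x∉q (_ ∷ p) (false ∷ q) (there x∈p─q) (there x∈q) = x∈p─q⇒x∉q p q x∈p─q x∈q

∧≡true⁻ : ∀ {a b} → a ∧ b ≡ true → a ≡ true × b ≡ true
∧≡true⁻ {true} {true} _ = refl , refl

not≡true⁻ : ∀ {a} → not a ≡ true → a ≡ false
not≡true⁻ {false} _ = refl

lookup≡false⇒∉ : ∀ {n} {p : Subset n} {x} → lookup p x ≡ false → x ∉ p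
lookup≡false⇒∉ px≡false x∈p with trans (sym ([]=⇒lookup x∈p)) px≡false
... | ()

anyFin⁻ : ∀ {n} (f : Fin n → Bool) → anyFin f ≡ true → ∃[ u ] f u ≡ true
anyFin⁻ {suc n} f any-f with f zero in f0
... | true  = zero , f0
... | false with anyFin⁻ (λ i → f (suc i)) any-f
...   | u , fu = suc u , fu

anyFin⁺ : ∀ {n} (f : Fin n → Bool) u → f u ≡ true → anyFin f ≡ true
anyFin⁺ f zero    fu rewrite fu = refl
anyFin⁺ f (suc u) fu with f zero
... | true  = refl
... | false = anyFin⁺ (λ i → f (suc i)) u fu

module _ {n} (D : Digraph n) {A : Subset n} where

  ∈Nout⁻ : ∀ {v} → v ∈ Nout D A → v ∉ A × ∃[ u ] (u ∈ A × D u v ≡ true)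
  ∈Nout⁻ {v} v∈N with ∧≡true⁻ (trans (sym (lookup∘tabulate _ v)) ([]=⇒lookup v∈N))
  ... | ¬Av , any with anyFin⁻ _ any
  ...   | u , edge with ∧≡true⁻ edge
  ...     | Au , Duv = lookup≡false⇒∉ (not≡true⁻ ¬Av) , u , lookup⇒[]= u A Au , Duv

  ∈Nout⁺ : ∀ {u v} → v ∉ A → u ∈ A → D u v ≡ true → v ∈ Nout D A
  ∈Nout⁺ {u} {v} v∉A u∈A Duv = lookup⇒[]= v _ (trans (lookup∘tabulate _ v) entry)
    where
    edge : lookup A u ∧ D u v ≡ true
    edge rewrite []=⇒lookup u∈A | Duv = refl

    entry : not (lookup A v) ∧ anyFin (λ u → lookup A u ∧ D u v) ≡ true
    entry with lookup A v in Av
    ... | true  = contradiction (lookup⇒[]= v A Av) v∉A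
    ... | false = anyFin⁺ _ u edge

Nout⊆Nclosed : ∀ {n} (D : Digraph n) {A B : Subset n} → A ⊆ B → Nout D A ⊆ Nclosed D B
Nout⊆Nclosed D {B = B} A⊆B {v} v∈N with ∈Nout⁻ D v∈N | v ∈? B
... | _ | yes v∈B = p⊆p∪q _ v∈B
... | _ , u , u∈A , Duv | no v∉B = q⊆p∪q B _ (∈Nout⁺ D v∉B (A⊆B u∈A) Duv)

module _ {n q} {X : Fin q → Subset n} (chain : ∀ j k → j Data.Fin.< k → X j ⊂ X k) where

  chain-mono : ∀ {j k} → toℕ j ≤ toℕ k → X j ⊆ X k
  chain-mono {j} {k} j≤k with toℕ j <? toℕ k
  ... | yes j<k = proj₁ (chain j k j<k)
  ... | no  j≮k rewrite toℕ-injective (≤-antisym j≤k (≮⇒≥ j≮k)) = λ x∈ → x∈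

  Xext-suc : ∀ {i} (i<q : i < q) → Xext X (suc i) ≡ X (fromℕ< i<q)
  Xext-suc {i} i<q with i <? q
  ... | yes _   = refl
  ... | no  i≮q = contradiction i<q i≮q

  ⊆Xext : ∀ {k i} → toℕ k ≤ i → X k ⊆ Xext X (suc i)
  ⊆Xext {k} {i} k≤i with i <? q
  ... | yes i<q = chain-mono (subst (toℕ k ≤_) (sym (toℕ-fromℕ< i<q)) k≤i)
  ... | no  _   = λ _ → ∈⊤

  Xext⊆ : ∀ {k i} → i ≤ toℕ k → Xext X (suc i) ⊆ X k
  Xext⊆ {k} {i} i≤k rewrite Xext-suc (≤-<-trans i≤k (toℕ<n k)) =
    chain-mono (subst (_≤ toℕ k) (sym (toℕ-fromℕ< (≤-<-trans i≤k (toℕ<n k)))) i≤k)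

  Nout∩Zset≡∅ : ∀ (D : Digraph n) k i {v} → v ∈ Nout D (X k) → v ∉ Zset D X i
  Nout∩Zset≡∅ D k zero v∈N v∈Z =
    proj₁ (∈Nout⁻ D v∈N) (Xext⊆ z≤n (p─q⊆p _ _ v∈Z))
  Nout∩Zset≡∅ D k (suc i) v∈N v∈Z with toℕ k ≤? i
  ... | yes k≤i = x∈p─q⇒x∉q _ _ v∈Z (Nout⊆Nclosed D (⊆Xext k≤i) v∈N)
  ... | no  k≰i = proj₁ (∈Nout⁻ D v∈N) (Xext⊆ (≰⇒> k≰i) (p─q⊆p _ _ v∈Z))

lemma6 : ∀ {n q} (D : Digraph n) (s t : Fin n) (ℓ : ℕ) (X : Fin q → Subset n)
    → IsMinSepSize D s t ℓ
    → 0 < ℓ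
    → (∀ k → s ∈ X k)
    → (∀ k → t ∉ X k)
    → (∀ k u → u ∈ X k → D u t ≡ false)
    → (∀ j k → j Data.Fin.< k → X j ⊂ X k)
    → (∀ k v → v ∈ X k → Reach D (X k) s v)
    → (∀ k v → v ∈ Nout D (X k) → Reach D (∁ (X k)) v t)
    → (∀ k → ∣ Nout D (X k) ∣ ≡ ℓ)
    → (∀ S → IsSeparator D s t S → ∣ S ∣ ≡ ℓ → ∀ v → v ∈ S → ∃[ k ] v ∈ Nout D (X k))
    → ∀ S → IsMinimalSeparator D s t S
    → (∃[ i ] (i ≤ q × ∃[ v ] (v ∈ S × v ∈ Zset D X i)))
    → suc ℓ ≤ ∣ S ∣
lemma6 D s t ℓ X (_ , ℓ-minimum) _ _ _ _ chain _ _ _ minimum⊆⋃Nout S (S-sep , _)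
       (i , _ , v , v∈S , v∈Zᵢ) with ℓ <? ∣ S ∣
... | yes ℓ<∣S∣ = ℓ<∣S∣
... | no  ℓ≮∣S∣ with minimum⊆⋃Nout S S-sep (≤-antisym (≮⇒≥ ℓ≮∣S∣) (ℓ-minimum S S-sep)) v v∈S
...   | k , v∈Nₖ = ⊥-elim (Nout∩Zset≡∅ chain D k i v∈Nₖ v∈Zᵢ)
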